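{- Let $G$ be an ordinary wheel consisting of the cycle $v_1v_2\dots v_kv_1$ ($k\ge3$) and an inner vertex $v$ adjacent to all $v_i$, with principal path $\overrightarrow{v_kv_1v_2}$. Then $P(G-\overrightarrow{v_kv_1v_2})$ contains a non-vanishing monomial $\eta\, v_1^0v_2^0v_k^0v^{\alpha}\prod_{i=3}^{k-1}v_i^{\alpha_i}$ with $\alpha_i\le2$ and $\alpha\le4$ if and only if $k$ is even.
   Context: For a graph $G$, vertices are also variables and $P(G)=\prod_{uv\in E(G),\,u<v}(u-v)$ for a fixed arbitrary orientation (only the overall sign depends on it). A monomial is non-vanishing in $P(G)$ if its coefficient is nonzero. $G-\overrightarrow{v_kv_1v_2}$ denotes $G$ with the edges $v_kv_1$ and $v_1v_2$ deleted (vertices kept). -}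

module Defs where

open import Data.Nat using (ℕ; zero; suc; _≤_; _<_; _∸_)
open import Data.Integer using (ℤ; +_; -_) renaming (_+_ to _+ℤ_; _*_ to _*ℤ_)
open import Data.Fin using (Fin; toℕ; inject₁; fromℕ)
open import Data.Fin.Properties using () renaming (_≟_ to _≟F_)
open import Data.List using (List; []; _∷_; _++_; concatMap; map; filter; foldr; allFin)
open import Data.Vec using (Vec; replicate; zipWith; updateAt)
open import Data.Vec.Properties using (≡-dec)
open import Data.Nat.Properties using () renaming (_≟_ to _≟ℕ_)
open import Data.Product using (_×_; _,_)
open import Data.Sum using (_⊎_)
open import Relation.Nullary using (¬_; yes; no; Dec)
open import Relation.Nullary.Decidable using (_×-dec_; _⊎-dec_; ¬?)
open import Relation.Binary.PropositionalEquality using (_≡_)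

-- Polynomials in ℤ[x_0,…,x_{n-1}] as (non-normalised) lists of terms
-- (coefficient, exponent vector).  The coefficient of a monomial is the
-- sum of the coefficients of all terms with that exponent vector; this
-- is well defined on the polynomial ring.

Monomial : ℕ → Set
Monomial n = Vec ℕ n

Poly : ℕ → Set
Poly n = List (ℤ × Monomial n)

one : ∀ {n} → Poly n
one = (+ 1 , replicate _ 0) ∷ []

var : ∀ {n} → Fin n → Poly n
var i = (+ 1 , updateAt (replicate _ 0) i (λ _ → 1)) ∷ []

negP : ∀ {n} → Poly n → Poly n
negP = map (λ { (c , m) → (- c , m) })

_⊕_ : ∀ {n} → Poly n → Poly n → Poly n
p ⊕ q = p ++ q

_⊗_ : ∀ {n} → Poly n → Poly n → Poly n
p ⊗ q = concatMap (λ { (c , m) → map (λ { (d , m') → (c *ℤ d , zipWith Data.Nat._+_ m m') }) q }) p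

coeff : ∀ {n} → Monomial n → Poly n → ℤ
coeff m [] = + 0
coeff m ((c , m') ∷ p) with ≡-dec _≟ℕ_ m' m
... | yes _ = c +ℤ coeff m p
... | no  _ = coeff m p

-- Graphs given by edge lists; P(G) = ∏_{(a,b) ∈ E} (x_a - x_b)
-- (the orientation only affects the overall sign).

Edge : ℕ → Set
Edge n = Fin n × Fin n

graphPoly : ∀ {n} → List (Edge n) → Poly n
graphPoly = foldr (λ { (a , b) acc → (var a ⊕ negP (var b)) ⊗ acc }) one

-- The ordinary wheel with rim v_1 … v_k v_1 and hub v.
-- Vertices: Fin (suc k).  Rim vertex v_i (1 ≤ i ≤ k) is  rim j  with
-- toℕ j = i - 1 (j : Fin k); the hub v is  hub = fromℕ k.

rim : ∀ {k} → Fin k → Fin (suc k)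
rim = inject₁

hub : ∀ {k} → Fin (suc k)
hub {k} = fromℕ k

RimAdj : (k : ℕ) → Fin k → Fin k → Set
RimAdj k a b = (toℕ b ≡ suc (toℕ a)) ⊎ (suc (toℕ a) ≡ k × toℕ b ≡ 0)

rimAdj? : ∀ k (a b : Fin k) → Dec (RimAdj k a b)
rimAdj? k a b = (toℕ b ≟ℕ suc (toℕ a)) ⊎-dec ((suc (toℕ a) ≟ℕ k) ×-dec (toℕ b ≟ℕ 0))

wheelEdges : (k : ℕ) → List (Edge (suc k))
wheelEdges k =
  map (λ j → (rim j , hub)) (allFin k)
  ++ concatMap (λ a → map (λ b → (rim a , rim b)) (filter (rimAdj? k a) (allFin k))) (allFin k)

-- The principal path v_k v_1 v_2 consists of the edges v_k v_1 and v_1 v_2,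
-- i.e. (0-based rim indices) {k-1, 0} and {0, 1}.
OnPath : (k : ℕ) → Edge (suc k) → Set
OnPath k (a , b) = SameℕEdge (toℕ a , toℕ b) (k ∸ 1 , 0) ⊎ SameℕEdge (toℕ a , toℕ b) (0 , 1)
  where
  SameℕEdge : ℕ × ℕ → ℕ × ℕ → Set
  SameℕEdge (a , b) (c , d) = (a ≡ c × b ≡ d) ⊎ (a ≡ d × b ≡ c)

onPath? : ∀ k (e : Edge (suc k)) → Dec (OnPath k e)
onPath? k (a , b) = sm (toℕ a) (toℕ b) (k ∸ 1) 0 ⊎-dec sm (toℕ a) (toℕ b) 0 1
  where
  sm : ∀ a b c d → Dec ((a ≡ c × b ≡ d) ⊎ (a ≡ d × b ≡ c))
  sm a b c d = ((a ≟ℕ c) ×-dec (b ≟ℕ d)) ⊎-dec ((a ≟ℕ d) ×-dec (b ≟ℕ c))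

wheelMinusPath : (k : ℕ) → List (Edge (suc k))
wheelMinusPath k = filter (λ e → ¬? (onPath? k e)) (wheelEdges k)

{-# OPTIONS --safe #-}

-- A non-vanishing monomial of P(G − v_k v_1 v_2) has degree |E| = 2k − 2, which is exactly the
-- sum of the exponent bounds, so the only candidate is v⁴ ∏_{i=3}^{k−1} v_i². The spokes at v_1, v_2, v_k and the edge v_2v_3 must
-- use v and v_3; what remains is the fan with hub v over the path v_3 … v_k, whose coefficient a_r
-- (r = k − 4) satisfies a_0 = −1 and a_{r+1} = −a_r − 1, since once the hub is used at v_3 every
-- later edge is forced. Hence the coefficient is −1 for even k and 0 for odd k.

module Submission where

open import Defs
open import Data.Nat using (ℕ; zero; suc; pred; _≤_; _<_; z≤n; s≤s)
  renaming (_+_ to _+ℕ_)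
open import Data.Nat.Divisibility using (_∣_; divides; ∣-refl; ∣⇒≤; ∣m∣n⇒∣m+n; ∣m+n∣m⇒∣n)
import Data.Nat.Properties as ℕ
open import Data.Integer using (ℤ; +_; -_; -[1+_]; _+_; _*_; _-_)
import Data.Integer.Properties as ℤ
open import Data.Integer.Solver using (module +-*-Solver)
open import Data.Fin using (Fin; toℕ; inject₁; fromℕ) renaming (zero to fzero; suc to fsuc)
import Data.Fin.Properties as Fin
open import Data.List using (List; []; _∷_; _++_; [_]; _∷ʳ_; map; length; filter; concatMap; tabulate; allFin)
import Data.List.Properties as List
open import Data.List.Relation.Unary.All as All using (All; []; _∷_)
import Data.List.Relation.Unary.All.Properties as All
open import Data.List.Relation.Unary.Any using (here; there)
open import Data.List.Membership.Propositional using (_∈_)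
open import Data.List.Relation.Unary.Unique.Propositional using (Unique; []; _∷_)
import Data.List.Relation.Unary.Unique.Propositional.Properties as Unique
import Data.List.Membership.Propositional.Properties as ∈
open import Data.Fin.Relation.Unary.Top using (view; ‵fromℕ; ‵inject₁)
import Data.List.Relation.Binary.Permutation.Propositional as ↭
open ↭ using (_↭_; ↭-sym; ↭-trans)
import Data.List.Relation.Binary.Permutation.Propositional.Properties as ↭
open import Data.Vec using (Vec; []; _∷_; lookup; replicate; zipWith; updateAt; sum)
open import Data.Vec.Properties using (≡-dec; updateAt-updateAt; updateAt-id-local; updateAt-updateAt-local;
  updateAt-commutes; lookup∘updateAt; lookup∘updateAt′; lookup-replicate)
open import Data.Product using (Σ; _×_; _,_)
open import Data.Sum using (_⊎_; inj₁; inj₂; [_,_]′)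
open import Data.Empty using (⊥-elim)
open import Function using (_∘_)
open import Function.Bundles using (_⇔_; mk⇔; Equivalence)
open import Function.Construct.Composition using (_⇔-∘_)
open import Function.Construct.Symmetry using (⇔-sym)
open import Relation.Nullary using (¬_; ¬?; Dec; yes; no; contradiction)
open import Relation.Unary using (Pred; Decidable)
open import Level using (0ℓ)
open import Relation.Binary.PropositionalEquality hiding ([_])

private variable n : ℕ

ifNonZero : ℕ → ℤ → ℤ
ifNonZero zero    _ = + 0
ifNonZero (suc _) x = x

unit : Fin n → Monomial n
unit i = updateAt (replicate _ 0) i (λ _ → 1)

raise lower : Fin n → Monomial n → Monomial n
raise i m = updateAt m i suc
lower i m = updateAt m i pred

zipWith-+-replicate-0 : (m : Monomial n) → zipWith _+ℕ_ (replicate n 0) m ≡ m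
zipWith-+-replicate-0 []      = refl
zipWith-+-replicate-0 (x ∷ m) = cong (x ∷_) (zipWith-+-replicate-0 m)

unit+≡raise : (i : Fin n) (m : Monomial n) → zipWith _+ℕ_ (unit i) m ≡ raise i m
unit+≡raise fzero    (x ∷ m) = cong (suc x ∷_) (zipWith-+-replicate-0 m)
unit+≡raise (fsuc i) (x ∷ m) = cong (x ∷_) (unit+≡raise i m)

lower-raise : (i : Fin n) (m : Monomial n) → lower i (raise i m) ≡ m
lower-raise i m = trans (updateAt-updateAt i m) (updateAt-id-local i m refl)

raise-lower : (i : Fin n) (m : Monomial n) {t : ℕ} → lookup m i ≡ suc t → raise i (lower i m) ≡ m
raise-lower i m eq = trans (updateAt-updateAt-local i m (cong (suc ∘ pred) eq)) (updateAt-id-local i m (sym eq))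

lookup-raise : (i : Fin n) (m : Monomial n) → lookup (raise i m) i ≡ suc (lookup m i)
lookup-raise i m = lookup∘updateAt i m

coeff-++ : (m : Monomial n) (p q : Poly n) → coeff m (p ++ q) ≡ coeff m p + coeff m q
coeff-++ m []             q = sym (ℤ.+-identityˡ _)
coeff-++ m ((c , m') ∷ p) q with ≡-dec ℕ._≟_ m' m
... | yes _ = trans (cong (_+_ c) (coeff-++ m p q)) (sym (ℤ.+-assoc c _ _))
... | no  _ = coeff-++ m p q

scaleShift : ℤ → Monomial n → ℤ × Monomial n → ℤ × Monomial n
scaleShift c v (d , m') = (c * d , zipWith _+ℕ_ v m')

∷-⊗ : ∀ c (v : Monomial n) p q → ((c , v) ∷ p) ⊗ q ≡ map (scaleShift c v) q ++ (p ⊗ q)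
∷-⊗ c v p q = cong (_++ (p ⊗ q)) (List.map-cong (λ _ → refl) q)

coeff-scaleShift : ∀ (m m₀ : Monomial n) c v q → (∀ m' → zipWith _+ℕ_ v m' ≡ m ⇔ m' ≡ m₀) →
                   coeff m (map (scaleShift c v) q) ≡ c * coeff m₀ q
coeff-scaleShift m m₀ c v [] shift = sym (ℤ.*-zeroʳ c)
coeff-scaleShift m m₀ c v ((d , m') ∷ q) shift
  with ≡-dec ℕ._≟_ (zipWith _+ℕ_ v m') m | ≡-dec ℕ._≟_ m' m₀
... | yes _  | yes _  = trans (cong (_+_ (c * d)) (coeff-scaleShift m m₀ c v q shift)) (sym (ℤ.*-distribˡ-+ c d _))
... | yes eq | no ne  = contradiction (Equivalence.to (shift m') eq) ne
... | no ne  | yes eq = contradiction (Equivalence.from (shift m') eq) ne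
... | no _   | no _   = coeff-scaleShift m m₀ c v q shift

coeff-scaleShift-absent : ∀ (m : Monomial n) c v q → (∀ m' → zipWith _+ℕ_ v m' ≢ m) →
                          coeff m (map (scaleShift c v) q) ≡ + 0
coeff-scaleShift-absent m c v [] none = refl
coeff-scaleShift-absent m c v ((d , m') ∷ q) none with ≡-dec ℕ._≟_ (zipWith _+ℕ_ v m') m
... | yes eq = contradiction eq (none m')
... | no _   = coeff-scaleShift-absent m c v q none

coeff-scaleShift-unit : ∀ (m : Monomial n) i c q →
  coeff m (map (scaleShift c (unit i)) q) ≡ ifNonZero (lookup m i) (c * coeff (lower i m) q)
coeff-scaleShift-unit m i c q with lookup m i in eq
... | zero  = coeff-scaleShift-absent m c (unit i) q λ m' e →
                ℕ.1+n≢0 (trans (sym (lookup-raise i m'))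
                          (trans (cong (λ v → lookup v i) (trans (sym (unit+≡raise i m')) e)) eq))
... | suc _ = coeff-scaleShift m (lower i m) c (unit i) q λ m' → mk⇔
                (λ e → trans (sym (lower-raise i m')) (cong (lower i) (trans (sym (unit+≡raise i m')) e)))
                (λ e → trans (unit+≡raise i m') (trans (cong (raise i) e) (raise-lower i m eq)))

graphCoeff : Monomial n → List (Edge n) → ℤ
graphCoeff m []            = coeff m one
graphCoeff m ((a , b) ∷ E) =
  ifNonZero (lookup m a) (graphCoeff (lower a m) E) - ifNonZero (lookup m b) (graphCoeff (lower b m) E)

ifNonZero-* : ∀ x c y → ifNonZero x (c * y) ≡ c * ifNonZero x y
ifNonZero-* zero    c y = sym (ℤ.*-zeroʳ c)
ifNonZero-* (suc _) c y = refl

coeff-graphPoly : (m : Monomial n) (E : List (Edge n)) → coeff m (graphPoly E) ≡ graphCoeff m E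
coeff-graphPoly m [] = refl
coeff-graphPoly m ((a , b) ∷ E) = begin
  coeff m (graphPoly ((a , b) ∷ E))
    ≡⟨ cong (coeff m) (trans (∷-⊗ (+ 1) (unit a) ((-[1+ 0 ] , unit b) ∷ []) P) (cong (Sa ++_) (∷-⊗ -[1+ 0 ] (unit b) [] P))) ⟩
  coeff m (Sa ++ (Sb ++ []))
    ≡⟨ trans (coeff-++ m Sa _) (cong (_+_ (coeff m Sa)) (trans (coeff-++ m Sb []) (ℤ.+-identityʳ _))) ⟩
  coeff m Sa + coeff m Sb
    ≡⟨ cong₂ _+_ (coeff-scaleShift-unit m a (+ 1) P) (coeff-scaleShift-unit m b -[1+ 0 ] P) ⟩
  ifNonZero (lookup m a) (+ 1 * coeff (lower a m) P) + ifNonZero (lookup m b) (-[1+ 0 ] * coeff (lower b m) P)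
    ≡⟨ cong₂ _+_ (trans (ifNonZero-* (lookup m a) (+ 1) _) (ℤ.*-identityˡ _))
                 (trans (ifNonZero-* (lookup m b) -[1+ 0 ] _) (ℤ.-1*i≡-i _)) ⟩
  ifNonZero (lookup m a) (coeff (lower a m) P) - ifNonZero (lookup m b) (coeff (lower b m) P)
    ≡⟨ cong₂ (λ x y → ifNonZero (lookup m a) x - ifNonZero (lookup m b) y)
             (coeff-graphPoly (lower a m) E) (coeff-graphPoly (lower b m) E) ⟩
  graphCoeff m ((a , b) ∷ E) ∎
  where
  open ≡-Reasoning
  P  = graphPoly E
  Sa = map (scaleShift (+ 1) (unit a)) P
  Sb = map (scaleShift -[1+ 0 ] (unit b)) P

lookup-lower : ∀ {i j : Fin n} (m : Monomial n) → i ≢ j → lookup (lower j m) i ≡ lookup m i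
lookup-lower {i = i} {j} m i≢j = lookup∘updateAt′ i j i≢j m

lower-comm : (i j : Fin n) (m : Monomial n) → lower i (lower j m) ≡ lower j (lower i m)
lower-comm i j m with i Fin.≟ j
... | yes refl = refl
... | no  i≢j  = updateAt-commutes i j i≢j m

ifNonZero-comm : ∀ x y z → ifNonZero x (ifNonZero y z) ≡ ifNonZero y (ifNonZero x z)
ifNonZero-comm zero    zero    z = refl
ifNonZero-comm zero    (suc _) z = refl
ifNonZero-comm (suc _) zero    z = refl
ifNonZero-comm (suc _) (suc _) z = refl

ifNonZero-distrib-- : ∀ x y z → ifNonZero x (y - z) ≡ ifNonZero x y - ifNonZero x z
ifNonZero-distrib-- zero    y z = refl
ifNonZero-distrib-- (suc _) y z = refl

chooseTwice : Monomial n → List (Edge n) → Fin n → Fin n → ℤ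
chooseTwice m E a c =
  ifNonZero (lookup m a) (ifNonZero (lookup (lower a m) c) (graphCoeff (lower c (lower a m)) E))

chooseTwice-comm : (m : Monomial n) (E : List (Edge n)) (a c : Fin n) → chooseTwice m E a c ≡ chooseTwice m E c a
chooseTwice-comm m E a c with a Fin.≟ c
... | yes refl = refl
... | no  a≢c  rewrite lookup-lower m (a≢c ∘ sym) | lookup-lower m a≢c | lower-comm c a m =
  ifNonZero-comm (lookup m a) (lookup m c) _

graphCoeff-swap : (m : Monomial n) (e f : Edge n) (E : List (Edge n)) → graphCoeff m (e ∷ f ∷ E) ≡ graphCoeff m (f ∷ e ∷ E)
graphCoeff-swap m (a , b) (c , d) E = begin
  graphCoeff m ((a , b) ∷ (c , d) ∷ E)
    ≡⟨ cong₂ _-_ (ifNonZero-distrib-- (lookup m a) _ _) (ifNonZero-distrib-- (lookup m b) _ _) ⟩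
  (T a c - T a d) - (T b c - T b d)
    ≡⟨ exchange (T a c) (T a d) (T b c) (T b d) ⟩
  (T a c - T b c) - (T a d - T b d)
    ≡⟨ cong₂ _-_ (cong₂ _-_ (chooseTwice-comm m E a c) (chooseTwice-comm m E b c))
                 (cong₂ _-_ (chooseTwice-comm m E a d) (chooseTwice-comm m E b d)) ⟩
  (T c a - T c b) - (T d a - T d b)
    ≡⟨ sym (cong₂ _-_ (ifNonZero-distrib-- (lookup m c) _ _) (ifNonZero-distrib-- (lookup m d) _ _)) ⟩
  graphCoeff m ((c , d) ∷ (a , b) ∷ E) ∎
  where
  open ≡-Reasoning
  open +-*-Solver
  T = chooseTwice m E
  exchange : ∀ p q r s → (p - q) - (r - s) ≡ (p - r) - (q - s)
  exchange = solve 4 (λ p q r s → (p :- q) :- (r :- s) := (p :- r) :- (q :- s)) refl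

graphCoeff-∷-cong : {E E' : List (Edge n)} → (∀ m → graphCoeff m E ≡ graphCoeff m E') →
                    ∀ e m → graphCoeff m (e ∷ E) ≡ graphCoeff m (e ∷ E')
graphCoeff-∷-cong eq (a , b) m =
  cong₂ (λ x y → ifNonZero (lookup m a) x - ifNonZero (lookup m b) y) (eq (lower a m)) (eq (lower b m))

graphCoeff-↭ : {E E' : List (Edge n)} → E ↭ E' → ∀ m → graphCoeff m E ≡ graphCoeff m E'
graphCoeff-↭ ↭.refl          m = refl
graphCoeff-↭ (↭.prep {xs} {ys} e p) m = graphCoeff-∷-cong {E = xs} {ys} (graphCoeff-↭ p) e m
graphCoeff-↭ (↭.swap {xs} {ys} e f p) m =
  trans (graphCoeff-swap m e f xs)
        (graphCoeff-∷-cong {E = e ∷ xs} {e ∷ ys} (graphCoeff-∷-cong {E = xs} {ys} (graphCoeff-↭ p) e) f m)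
graphCoeff-↭ (↭.trans p q)   m = trans (graphCoeff-↭ p m) (graphCoeff-↭ q m)

coeff-one-replicate : coeff (replicate n 0) one ≡ + 1
coeff-one-replicate {n} with ≡-dec ℕ._≟_ (replicate n 0) (replicate n 0)
... | yes _ = refl
... | no ne = contradiction refl ne

coeff-one-≢ : {m : Monomial n} → replicate n 0 ≢ m → coeff m one ≡ + 0
coeff-one-≢ {n} {m} ne with ≡-dec ℕ._≟_ (replicate n 0) m
... | yes eq = contradiction eq ne
... | no  _  = refl

ifNonZero-0 : ∀ x → ifNonZero x (+ 0) ≡ + 0
ifNonZero-0 zero    = refl
ifNonZero-0 (suc _) = refl

Avoids : Fin n → Edge n → Set
Avoids x (a , b) = x ≢ a × x ≢ b

graphCoeff-avoiding : ∀ {x : Fin n} (m : Monomial n) E → lookup m x ≢ 0 → All (Avoids x) E →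
                      graphCoeff m E ≡ + 0
graphCoeff-avoiding {x = x} m []                  mx≢0 [] =
  coeff-one-≢ λ eq → mx≢0 (trans (cong (λ v → lookup v x) (sym eq)) (lookup-replicate x 0))
graphCoeff-avoiding m ((a , b) ∷ E) mx≢0 ((x≢a , x≢b) ∷ avoids) =
  cong₂ _-_ (vanish a x≢a) (vanish b x≢b)
  where
  vanish : ∀ c → _ ≢ c → ifNonZero (lookup m c) (graphCoeff (lower c m) E) ≡ + 0
  vanish c x≢c = trans (cong (ifNonZero (lookup m c))
                              (graphCoeff-avoiding (lower c m) E (mx≢0 ∘ trans (sym (lookup-lower m x≢c))) avoids))
                       (ifNonZero-0 (lookup m c))

sum-replicate-0 : ∀ n → sum (replicate n 0) ≡ 0
sum-replicate-0 zero    = refl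
sum-replicate-0 (suc n) = sum-replicate-0 n

sum-lower : (i : Fin n) (m : Monomial n) {t : ℕ} → lookup m i ≡ suc t → sum m ≡ suc (sum (lower i m))
sum-lower fzero    (suc x ∷ m) refl = refl
sum-lower (fsuc i) (x ∷ m)     eq   = trans (cong (x +ℕ_) (sum-lower i m eq)) (ℕ.+-suc x _)

-≢0 : ∀ p q → p - q ≢ + 0 → p ≢ + 0 ⊎ q ≢ + 0
-≢0 p q p-q≢0 with p ℤ.≟ + 0
... | no  p≢0  = inj₁ p≢0
... | yes refl = inj₂ (λ q≡0 → p-q≢0 (cong (λ z → + 0 - z) q≡0))

sum-graphCoeff : (m : Monomial n) (E : List (Edge n)) → graphCoeff m E ≢ + 0 → sum m ≡ length E
sum-graphCoeff {n} m [] c≢0 with ≡-dec ℕ._≟_ (replicate n 0) m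
... | yes eq = trans (cong sum (sym eq)) (sum-replicate-0 n)
... | no  _  = contradiction refl c≢0
sum-graphCoeff m ((a , b) ∷ E) c≢0 = [ chosen a , chosen b ]′ (-≢0 _ _ c≢0)
  where
  chosen : ∀ c → ifNonZero (lookup m c) (graphCoeff (lower c m) E) ≢ + 0 → sum m ≡ suc (length E)
  chosen c ≢0 with lookup m c in eq
  ... | zero  = contradiction refl ≢0
  ... | suc _ = trans (sum-lower c m eq) (cong suc (sum-graphCoeff (lower c m) E ≢0))

monomial : List (Fin n) → Monomial n
monomial []       = replicate _ 0
monomial (x ∷ xs) = raise x (monomial xs)

lookup-monomial-≢ : ∀ {x y : Fin n} xs → x ≢ y → lookup (monomial (y ∷ xs)) x ≡ lookup (monomial xs) x
lookup-monomial-≢ xs x≢y = lookup∘updateAt′ _ _ x≢y (monomial xs)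

lookup-monomial-∷ : ∀ (x : Fin n) xs → lookup (monomial (x ∷ xs)) x ≡ suc (lookup (monomial xs) x)
lookup-monomial-∷ x xs = lookup-raise x (monomial xs)

lookup-monomial-∉ : ∀ {x : Fin n} {xs} → All (x ≢_) xs → lookup (monomial xs) x ≡ 0
lookup-monomial-∉ {x = x} []                = lookup-replicate x 0
lookup-monomial-∉ {xs = _ ∷ xs} (x≢y ∷ x∉) = trans (lookup-monomial-≢ xs x≢y) (lookup-monomial-∉ x∉)

raise-comm : (i j : Fin n) (m : Monomial n) → raise i (raise j m) ≡ raise j (raise i m)
raise-comm i j m with i Fin.≟ j
... | yes refl = refl
... | no  i≢j  = updateAt-commutes i j i≢j m

monomial-↭ : {xs ys : List (Fin n)} → xs ↭ ys → monomial xs ≡ monomial ys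
monomial-↭ ↭.refl                  = refl
monomial-↭ (↭.prep x p)            = cong (raise x) (monomial-↭ p)
monomial-↭ (↭.swap {xs} x y p)     = trans (raise-comm x y (monomial xs)) (cong (raise y ∘ raise x) (monomial-↭ p))
monomial-↭ (↭.trans p q)           = trans (monomial-↭ p) (monomial-↭ q)

sum-monomial : (xs : List (Fin n)) → sum (monomial xs) ≡ length xs
sum-monomial {n} []  = sum-replicate-0 n
sum-monomial (x ∷ xs) = begin
  sum (raise x (monomial xs))                 ≡⟨ sum-lower x (raise x (monomial xs)) (lookup-raise x (monomial xs)) ⟩
  suc (sum (lower x (raise x (monomial xs)))) ≡⟨ cong (suc ∘ sum) (lower-raise x (monomial xs)) ⟩
  suc (sum (monomial xs))                     ≡⟨ cong suc (sum-monomial xs) ⟩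
  suc (length xs)                             ∎
  where open ≡-Reasoning

doubled : {A : Set} → List A → List A
doubled []       = []
doubled (x ∷ xs) = x ∷ x ∷ doubled xs

All-doubled : ∀ {A : Set} {P : A → Set} {xs} → All P xs → All P (doubled xs)
All-doubled []         = []
All-doubled (px ∷ pxs) = px ∷ px ∷ All-doubled pxs

lookup-monomial-doubled : ∀ {x : Fin n} {xs} → Unique xs → x ∈ xs → lookup (monomial (doubled xs)) x ≡ 2
lookup-monomial-doubled {x = x} {x ∷ xs} (x∉ ∷ _) (here refl) = begin
  lookup (monomial (x ∷ x ∷ doubled xs)) x     ≡⟨ lookup-monomial-∷ x (x ∷ doubled xs) ⟩
  suc (lookup (monomial (x ∷ doubled xs)) x)   ≡⟨ cong suc (lookup-monomial-∷ x (doubled xs)) ⟩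
  suc (suc (lookup (monomial (doubled xs)) x)) ≡⟨ cong (suc ∘ suc) (lookup-monomial-∉ (All-doubled x∉)) ⟩
  2                                            ∎
  where open ≡-Reasoning
lookup-monomial-doubled {xs = y ∷ xs} (y∉ ∷ uniq) (there x∈) =
  trans (lookup-monomial-≢ (y ∷ doubled xs) x≢y)
        (trans (lookup-monomial-≢ (doubled xs) x≢y) (lookup-monomial-doubled uniq x∈))
  where x≢y = λ x≡y → All.lookup y∉ x∈ (sym x≡y)

-- Opaque, so that the unifier can read the multisets off the goals below.
opaque
  coeffOf : List (Fin n) → List (Edge n) → ℤ
  coeffOf xs = graphCoeff (monomial xs)

opaque
  unfolding coeffOf

  coeffOf-[] : coeffOf {n} [] [] ≡ + 1
  coeffOf-[] {n} = coeff-one-replicate {n}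

  coeff-monomial-graphPoly : ∀ (xs : List (Fin n)) E → coeff (monomial xs) (graphPoly E) ≡ coeffOf xs E
  coeff-monomial-graphPoly xs E = coeff-graphPoly (monomial xs) E

  coeffOf-↭ : ∀ {xs : List (Fin n)} {E E'} → E ↭ E' → coeffOf xs E ≡ coeffOf xs E'
  coeffOf-↭ {xs = xs} p = graphCoeff-↭ p (monomial xs)

  coeffOf-avoiding : ∀ {x : Fin n} {xs E} → x ∈ xs → All (Avoids x) E → coeffOf xs E ≡ + 0
  coeffOf-avoiding {x = x} {xs} {E} x∈xs = graphCoeff-avoiding (monomial xs) E (occurs x∈xs)
    where
    occurs : ∀ {ys} → x ∈ ys → lookup (monomial ys) x ≢ 0
    occurs {y ∷ ys} (here refl) = ℕ.1+n≢0 ∘ trans (sym (lookup-raise x (monomial ys)))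
    occurs {y ∷ ys} (there x∈) with x Fin.≟ y
    ... | yes refl = ℕ.1+n≢0 ∘ trans (sym (lookup-raise x (monomial ys)))
    ... | no  x≢y  = occurs x∈ ∘ trans (sym (lookup-monomial-≢ ys x≢y))

  private
    absent : ∀ {a : Fin n} {xs} z → All (a ≢_) xs → ifNonZero (lookup (monomial xs) a) z ≡ + 0
    absent z a∉ rewrite lookup-monomial-∉ a∉ = refl

    present : ∀ {a : Fin n} {xs ys} E → xs ↭ a ∷ ys →
              ifNonZero (lookup (monomial xs) a) (graphCoeff (lower a (monomial xs)) E) ≡ coeffOf ys E
    present {a = a} {ys = ys} E p
      rewrite monomial-↭ p | lookup-raise a (monomial ys) | lower-raise a (monomial ys) = refl

  coeffOf-∷ : ∀ {a b : Fin n} {xs ys zs E} → xs ↭ a ∷ ys → xs ↭ b ∷ zs →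
              coeffOf xs ((a , b) ∷ E) ≡ coeffOf ys E - coeffOf zs E
  coeffOf-∷ {E = E} p q = cong₂ _-_ (present E p) (present E q)

  coeffOf-∷ˡ : ∀ {a b : Fin n} {xs ys E} → xs ↭ a ∷ ys → All (b ≢_) xs →
               coeffOf xs ((a , b) ∷ E) ≡ coeffOf ys E
  coeffOf-∷ˡ {E = E} p b∉ = trans (cong₂ _-_ (present E p) (absent _ b∉)) (ℤ.+-identityʳ _)

  coeffOf-∷ʳ : ∀ {a b : Fin n} {xs zs E} → All (a ≢_) xs → xs ↭ b ∷ zs →
               coeffOf xs ((a , b) ∷ E) ≡ - coeffOf zs E
  coeffOf-∷ʳ {E = E} a∉ q = trans (cong₂ _-_ (absent _ a∉) (present E q)) (ℤ.+-identityˡ _)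

spokes : Fin n → List (Fin n) → List (Edge n)
spokes h = map (λ x → (x , h))

pathEdges : Fin n → List (Fin n) → List (Edge n)
pathEdges u []       = []
pathEdges u (v ∷ vs) = (u , v) ∷ pathEdges v vs

-- The path u ∷ vs ∷ʳ z with a spoke from the hub h to every vertex but z.
fan : (h u : Fin n) → List (Fin n) → Fin n → List (Edge n)
fan h u []       z = (u , h) ∷ (u , z) ∷ []
fan h u (v ∷ vs) z = (u , h) ∷ (u , v) ∷ fan h v vs z

fan-↭ : ∀ (h u : Fin n) vs z → fan h u vs z ↭ spokes h (u ∷ vs) ++ pathEdges u (vs ∷ʳ z)
fan-↭ h u []       z = ↭.refl
fan-↭ h u (v ∷ vs) z = ↭.prep (u , h) (↭-trans (↭.prep (u , v) (fan-↭ h v vs z))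
                                               (↭-sym (↭.shift (u , v) (spokes h (v ∷ vs)) _)))

length-fan : ∀ (h u : Fin n) vs z → length (fan h u vs z) ≡ length (doubled (u ∷ vs))
length-fan h u []       z = refl
length-fan h u (v ∷ vs) z = cong (suc ∘ suc) (length-fan h v vs z)

fan-avoids : ∀ {x h u : Fin n} {vs z} → x ≢ h → x ≢ z → All (x ≢_) (u ∷ vs) → All (Avoids x) (fan h u vs z)
fan-avoids {vs = []}     x≢h x≢z (x≢u ∷ [])         = (x≢u , x≢h) ∷ (x≢u , x≢z) ∷ []
fan-avoids {vs = v ∷ vs} x≢h x≢z (x≢u ∷ x≢v ∷ x∉vs) =
  (x≢u , x≢h) ∷ (x≢u , x≢v) ∷ fan-avoids x≢h x≢z (x≢v ∷ x∉vs)

alternating : ℕ → ℤ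
alternating zero    = -[1+ 0 ]
alternating (suc r) = - (+ 1 + alternating r)

-- With no hub factor left, every edge must contribute its first endpoint.
coeffOf-fan-hubFree : ∀ (h u : Fin n) vs z → Unique (u ∷ vs ∷ʳ z) → All (h ≢_) (u ∷ vs ∷ʳ z) →
                      coeffOf (doubled (u ∷ vs)) (fan h u vs z) ≡ + 1
coeffOf-fan-hubFree h u [] z ((u≢z ∷ []) ∷ _) (h≢u ∷ _) = begin
  coeffOf (u ∷ u ∷ []) ((u , h) ∷ (u , z) ∷ []) ≡⟨ coeffOf-∷ˡ ↭.refl (h≢u ∷ h≢u ∷ []) ⟩
  coeffOf (u ∷ []) ((u , z) ∷ [])               ≡⟨ coeffOf-∷ˡ ↭.refl (u≢z ∘ sym ∷ []) ⟩
  coeffOf [] []                                 ≡⟨ coeffOf-[] ⟩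
  + 1                                           ∎
  where open ≡-Reasoning
coeffOf-fan-hubFree h u (v ∷ vs) z ((u≢v ∷ u∉) ∷ uniq) (h≢u ∷ h∉) = begin
  coeffOf (u ∷ u ∷ v ∷ v ∷ D) ((u , h) ∷ (u , v) ∷ F)
    ≡⟨ coeffOf-∷ˡ ↭.refl (All-doubled (h≢u ∷ All.++⁻ˡ (v ∷ vs) h∉)) ⟩
  coeffOf (u ∷ v ∷ v ∷ D) ((u , v) ∷ F)
    ≡⟨ coeffOf-∷ ↭.refl (↭.swap u v ↭.refl) ⟩
  coeffOf (v ∷ v ∷ D) F - coeffOf (u ∷ v ∷ D) F
    ≡⟨ cong₂ _-_ (coeffOf-fan-hubFree h v vs z uniq h∉)
                 (coeffOf-avoiding (here refl) (fan-avoids (h≢u ∘ sym) u≢z (u≢v ∷ All.++⁻ˡ vs u∉))) ⟩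
  + 1 - + 0
    ∎
  where
  open ≡-Reasoning
  D   = doubled vs
  F   = fan h v vs z
  u≢z = All.head (All.++⁻ʳ vs u∉)

coeffOf-fan-hubOnce : ∀ (h u : Fin n) vs z → Unique (u ∷ vs ∷ʳ z) → All (h ≢_) (u ∷ vs ∷ʳ z) →
                      coeffOf (h ∷ u ∷ doubled vs) (fan h u vs z) ≡ alternating (length vs)
coeffOf-fan-hubOnce h u [] z ((u≢z ∷ []) ∷ _) (h≢u ∷ h≢z ∷ []) = begin
  coeffOf (h ∷ u ∷ []) ((u , h) ∷ (u , z) ∷ [])
    ≡⟨ coeffOf-∷ (↭.swap h u ↭.refl) ↭.refl ⟩
  coeffOf (h ∷ []) ((u , z) ∷ []) - coeffOf (u ∷ []) ((u , z) ∷ [])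
    ≡⟨ cong₂ _-_ (coeffOf-avoiding (here refl) ((h≢u , h≢z) ∷ []))
                 (trans (coeffOf-∷ˡ ↭.refl (u≢z ∘ sym ∷ [])) coeffOf-[]) ⟩
  + 0 - + 1
    ∎
  where open ≡-Reasoning
coeffOf-fan-hubOnce h u (v ∷ vs) z ((u≢v ∷ u∉) ∷ uniq) (h≢u ∷ h∉) = begin
  coeffOf (h ∷ u ∷ v ∷ v ∷ D) ((u , h) ∷ (u , v) ∷ F)
    ≡⟨ coeffOf-∷ (↭.swap h u ↭.refl) ↭.refl ⟩
  coeffOf (h ∷ v ∷ v ∷ D) ((u , v) ∷ F) - coeffOf (u ∷ v ∷ v ∷ D) ((u , v) ∷ F)
    ≡⟨ cong₂ _-_ (coeffOf-∷ʳ (u≢h ∷ u≢v ∷ u≢v ∷ All-doubled u∉vs) (↭.swap h v ↭.refl))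
                 (coeffOf-∷ ↭.refl (↭.swap u v ↭.refl)) ⟩
  - coeffOf (h ∷ v ∷ D) F - (coeffOf (v ∷ v ∷ D) F - coeffOf (u ∷ v ∷ D) F)
    ≡⟨ cong₂ (λ x y → - x - y)
             (coeffOf-fan-hubOnce h v vs z uniq h∉)
             (cong₂ _-_ (coeffOf-fan-hubFree h v vs z uniq h∉)
                        (coeffOf-avoiding (here refl) (fan-avoids u≢h u≢z (u≢v ∷ u∉vs)))) ⟩
  - alternating (length vs) - (+ 1 - + 0)
    ≡⟨ step (alternating (length vs)) ⟩
  alternating (length (v ∷ vs))
    ∎
  where
  open ≡-Reasoning
  D    = doubled vs
  F    = fan h v vs z
  u≢h  = h≢u ∘ sym
  u∉vs = All.++⁻ˡ vs u∉
  u≢z  = All.head (All.++⁻ʳ vs u∉)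
  open +-*-Solver
  step : ∀ x → - x - (+ 1 - + 0) ≡ - (+ 1 + x)
  step = solve 1 (λ x → :- x :- (con (+ 1) :- con (+ 0)) := :- (con (+ 1) :+ x)) refl

Unique-∷ʳ⁻ : ∀ {A : Set} {xs : List A} {z} → Unique (xs ∷ʳ z) → All (z ≢_) xs
Unique-∷ʳ⁻ {xs = []}     _            = []
Unique-∷ʳ⁻ {xs = x ∷ xs} (x∉ ∷ uniq) = (All.head (All.++⁻ʳ xs x∉) ∘ sym) ∷ Unique-∷ʳ⁻ uniq

-- G − v_k v_1 v_2 for the wheel with hub h and rim w₀ w₁ ws z.
wheelMinusPathOn : (h w₀ w₁ : Fin n) → List (Fin n) → Fin n → List (Edge n)
wheelMinusPathOn h w₀ w₁ ws z = spokes h (w₀ ∷ w₁ ∷ ws ∷ʳ z) ++ pathEdges w₁ (ws ∷ʳ z)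

wheelMinusPathOn-↭ : ∀ (h w₀ w₁ u : Fin n) us z →
  wheelMinusPathOn h w₀ w₁ (u ∷ us) z ↭ (w₀ , h) ∷ (w₁ , h) ∷ (z , h) ∷ (w₁ , u) ∷ fan h u us z
wheelMinusPathOn-↭ h w₀ w₁ u us z = ↭.prep (w₀ , h) (↭.prep (w₁ , h) (begin
  spokes h ((u ∷ us) ∷ʳ z) ++ (w₁ , u) ∷ P
    ≡⟨ cong (_++ (w₁ , u) ∷ P) (List.map-++ (λ x → (x , h)) (u ∷ us) [ z ]) ⟩
  (S ++ [ (z , h) ]) ++ (w₁ , u) ∷ P
    ≡⟨ List.++-assoc S [ (z , h) ] ((w₁ , u) ∷ P) ⟩
  S ++ (z , h) ∷ (w₁ , u) ∷ P
    ↭⟨ ↭.shift (z , h) S ((w₁ , u) ∷ P) ⟩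
  (z , h) ∷ (S ++ (w₁ , u) ∷ P)
    ↭⟨ ↭.prep (z , h) (↭.shift (w₁ , u) S P) ⟩
  (z , h) ∷ (w₁ , u) ∷ (S ++ P)
    ↭⟨ ↭.prep (z , h) (↭.prep (w₁ , u) (↭-sym (fan-↭ h u us z))) ⟩
  (z , h) ∷ (w₁ , u) ∷ fan h u us z
    ∎))
  where
  open ↭.PermutationReasoning
  S = spokes h (u ∷ us)
  P = pathEdges u (us ∷ʳ z)

extremalMonomial : Fin n → List (Fin n) → List (Fin n)
extremalMonomial h ws = h ∷ h ∷ h ∷ h ∷ doubled ws

lookup-extremalMonomial-hub : ∀ {h : Fin n} {ws} → All (h ≢_) ws → lookup (monomial (extremalMonomial h ws)) h ≡ 4
lookup-extremalMonomial-hub {h = h} {ws} h∉ = begin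
  lookup (monomial (h ∷ h ∷ h ∷ h ∷ D)) h       ≡⟨ lookup-monomial-∷ h (h ∷ h ∷ h ∷ D) ⟩
  suc (lookup (monomial (h ∷ h ∷ h ∷ D)) h)     ≡⟨ cong suc (lookup-monomial-∷ h (h ∷ h ∷ D)) ⟩
  2 +ℕ lookup (monomial (h ∷ h ∷ D)) h          ≡⟨ cong (2 +ℕ_) (lookup-monomial-∷ h (h ∷ D)) ⟩
  3 +ℕ lookup (monomial (h ∷ D)) h              ≡⟨ cong (3 +ℕ_) (lookup-monomial-∷ h D) ⟩
  4 +ℕ lookup (monomial D) h                    ≡⟨ cong (4 +ℕ_) (lookup-monomial-∉ (All-doubled h∉)) ⟩
  4                                             ∎
  where
  open ≡-Reasoning
  D = doubled ws

lookup-extremalMonomial-≢ : ∀ {x h : Fin n} ws → x ≢ h →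
                    lookup (monomial (extremalMonomial h ws)) x ≡ lookup (monomial (doubled ws)) x
lookup-extremalMonomial-≢ {h = h} ws x≢h =
  trans (lookup-monomial-≢ (h ∷ h ∷ h ∷ doubled ws) x≢h)
  (trans (lookup-monomial-≢ (h ∷ h ∷ doubled ws) x≢h)
  (trans (lookup-monomial-≢ (h ∷ doubled ws) x≢h) (lookup-monomial-≢ (doubled ws) x≢h)))

length-wheelMinusPathOn : ∀ (h w₀ w₁ u : Fin n) us z →
  length (wheelMinusPathOn h w₀ w₁ (u ∷ us) z) ≡ length (extremalMonomial h (u ∷ us))
length-wheelMinusPathOn h w₀ w₁ u us z =
  trans (↭.↭-length (wheelMinusPathOn-↭ h w₀ w₁ u us z)) (cong (4 +ℕ_) (length-fan h u us z))

-- The rim vertices w₀, w₁, z have exponent 0, which forces their edges onto h and u.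
coeffOf-wheelMinusPathOn : ∀ (h w₀ w₁ u : Fin n) us z →
  Unique (w₀ ∷ w₁ ∷ (u ∷ us) ∷ʳ z) → All (h ≢_) (w₀ ∷ w₁ ∷ (u ∷ us) ∷ʳ z) →
  coeffOf (extremalMonomial h (u ∷ us)) (wheelMinusPathOn h w₀ w₁ (u ∷ us) z) ≡ alternating (length us)
coeffOf-wheelMinusPathOn h w₀ w₁ u us z (w₀∉ ∷ w₁∉ ∷ uniq) (h≢w₀ ∷ h≢w₁ ∷ h∉) = begin
  coeffOf (h ∷ h ∷ h ∷ h ∷ D) (wheelMinusPathOn h w₀ w₁ (u ∷ us) z)
    ≡⟨ coeffOf-↭ (wheelMinusPathOn-↭ h w₀ w₁ u us z) ⟩
  coeffOf (h ∷ h ∷ h ∷ h ∷ D) ((w₀ , h) ∷ (w₁ , h) ∷ (z , h) ∷ (w₁ , u) ∷ F)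
    ≡⟨ coeffOf-∷ʳ (≢h h≢w₀ ∷ ≢h h≢w₀ ∷ ≢h h≢w₀ ∷ ≢h h≢w₀ ∷ All-doubled w₀∉ws) ↭.refl ⟩
  - coeffOf (h ∷ h ∷ h ∷ D) ((w₁ , h) ∷ (z , h) ∷ (w₁ , u) ∷ F)
    ≡⟨ cong -_ (coeffOf-∷ʳ (≢h h≢w₁ ∷ ≢h h≢w₁ ∷ ≢h h≢w₁ ∷ All-doubled w₁∉ws) ↭.refl) ⟩
  - - coeffOf (h ∷ h ∷ D) ((z , h) ∷ (w₁ , u) ∷ F)
    ≡⟨ cong (-_ ∘ -_) (coeffOf-∷ʳ (≢h h≢z ∷ ≢h h≢z ∷ All-doubled z∉ws) ↭.refl) ⟩
  - - - coeffOf (h ∷ D) ((w₁ , u) ∷ F)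
    ≡⟨ cong (-_ ∘ -_ ∘ -_) (coeffOf-∷ʳ (≢h h≢w₁ ∷ All-doubled w₁∉ws) (↭.swap h u ↭.refl)) ⟩
  - - - - coeffOf (h ∷ u ∷ doubled us) F
    ≡⟨ trans (ℤ.neg-involutive _) (ℤ.neg-involutive _) ⟩
  coeffOf (h ∷ u ∷ doubled us) F
    ≡⟨ coeffOf-fan-hubOnce h u us z uniq h∉ ⟩
  alternating (length us)
    ∎
  where
  open ≡-Reasoning
  D    = doubled (u ∷ us)
  F    = fan h u us z
  ≢h   : ∀ {x} → h ≢ x → x ≢ h
  ≢h   = _∘ sym
  w₀∉ws = All.++⁻ˡ (u ∷ us) (All.tail w₀∉)
  w₁∉ws = All.++⁻ˡ (u ∷ us) w₁∉
  z∉ws  = Unique-∷ʳ⁻ uniq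
  h≢z   = All.head (All.++⁻ʳ (u ∷ us) h∉)

sum-mono-≤ : ∀ {k} (u v : Vec ℕ k) → (∀ i → lookup u i ≤ lookup v i) → sum u ≤ sum v
sum-mono-≤ []      []      u≤v = z≤n
sum-mono-≤ (x ∷ u) (y ∷ v) u≤v = ℕ.+-mono-≤ (u≤v fzero) (sum-mono-≤ u v (u≤v ∘ fsuc))

≤-pointwise-sum-≡ : ∀ {k} (u v : Vec ℕ k) → (∀ i → lookup u i ≤ lookup v i) → sum v ≤ sum u → u ≡ v
≤-pointwise-sum-≡ []      []      _   _  = refl
≤-pointwise-sum-≡ (x ∷ u) (y ∷ v) u≤v Σv≤Σu = cong₂ _∷_ (ℕ.≤-antisym x≤y y≤x) (≤-pointwise-sum-≡ u v (u≤v ∘ fsuc) Σv≤Σu′)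
  where
  x≤y   = u≤v fzero
  Σu≤Σv = sum-mono-≤ u v (u≤v ∘ fsuc)
  y≤x   = ℕ.+-cancelʳ-≤ (sum v) y x (ℕ.≤-trans Σv≤Σu (ℕ.+-monoʳ-≤ x Σu≤Σv))
  Σv≤Σu′ = ℕ.+-cancelˡ-≤ y (sum v) (sum u) (ℕ.≤-trans Σv≤Σu (ℕ.+-monoˡ-≤ (sum u) x≤y))

alternating-suc-suc : ∀ r → alternating (suc (suc r)) ≡ alternating r
alternating-suc-suc r = cancel (alternating r)
  where
  open +-*-Solver
  cancel : ∀ x → - (+ 1 + - (+ 1 + x)) ≡ x
  cancel = solve 1 (λ x → :- (con (+ 1) :+ :- (con (+ 1) :+ x)) := x) refl

2∣2+⇔2∣ : ∀ r → 2 ∣ suc (suc r) ⇔ 2 ∣ r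
2∣2+⇔2∣ r = mk⇔ (λ 2∣2+r → ∣m+n∣m⇒∣n 2∣2+r ∣-refl) (∣m∣n⇒∣m+n ∣-refl)

2∣4+⇔2∣ : ∀ r → 2 ∣ 4 +ℕ r ⇔ 2 ∣ r
2∣4+⇔2∣ r = 2∣2+⇔2∣ r ⇔-∘ 2∣2+⇔2∣ (2 +ℕ r)

2∤1 : ¬ 2 ∣ 1
2∤1 2∣1 = contradiction (∣⇒≤ 2∣1) λ { (s≤s ()) }

alternating≢0⇔2∣ : ∀ r → (alternating r ≢ + 0) ⇔ (2 ∣ r)
alternating≢0⇔2∣ zero          = mk⇔ (λ _ → divides 0 refl) (λ _ ())
alternating≢0⇔2∣ (suc zero)    = mk⇔ (λ ≢0 → contradiction refl ≢0) (⊥-elim ∘ 2∤1)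
alternating≢0⇔2∣ (suc (suc r)) rewrite alternating-suc-suc r = ⇔-sym (2∣2+⇔2∣ r) ⇔-∘ alternating≢0⇔2∣ r

tabulate-∷ʳ : ∀ {A : Set} {m} (f : Fin (suc m) → A) → tabulate f ≡ tabulate (f ∘ inject₁) ∷ʳ f (fromℕ m)
tabulate-∷ʳ {m = zero}  f = refl
tabulate-∷ʳ {m = suc m} f = cong (f fzero ∷_) (tabulate-∷ʳ (f ∘ fsuc))

pathEdges-tabulate : ∀ {m} (f : Fin (suc m) → Fin n) →
  pathEdges (f fzero) (tabulate (f ∘ fsuc)) ≡ tabulate (λ i → (f (inject₁ i) , f (fsuc i)))
pathEdges-tabulate {m = zero}  f = refl
pathEdges-tabulate {m = suc m} f = cong ((f fzero , f (fsuc fzero)) ∷_) (pathEdges-tabulate (f ∘ fsuc))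

filter-tabulate-single : ∀ {A : Set} {P : Pred A 0ℓ} (P? : Decidable P) {m} (f : Fin m → A) c →
  P (f c) → (∀ i → i ≢ c → ¬ P (f i)) → filter P? (tabulate f) ≡ [ f c ]
filter-tabulate-single P? f fzero Pc others =
  trans (List.filter-accept P? Pc)
        (cong (f fzero ∷_) (List.filter-none P? (All.tabulate⁺ λ i → others (fsuc i) λ ())))
filter-tabulate-single P? f (fsuc c) Pc others =
  trans (List.filter-reject P? (others fzero λ ()))
        (filter-tabulate-single P? (f ∘ fsuc) c Pc (λ i i≢c → others (fsuc i) (i≢c ∘ Fin.suc-injective)))

concatMap-tabulate-single : ∀ {A B : Set} {m} (g : A → List B) (f : Fin m → A) (e : Fin m → B) →
  (∀ i → g (f i) ≡ [ e i ]) → concatMap g (tabulate f) ≡ tabulate e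
concatMap-tabulate-single {m = zero}  g f e eq = refl
concatMap-tabulate-single {m = suc m} g f e eq =
  cong₂ _++_ (eq fzero) (concatMap-tabulate-single g (f ∘ fsuc) (e ∘ fsuc) (eq ∘ fsuc))

module _ {m : ℕ} where

  private
    k : ℕ
    k = suc (suc m)

    notOnPath : (e : Edge (suc k)) → Dec (¬ OnPath k e)
    notOnPath e = ¬? (onPath? k e)

    rimEdge : Fin (suc m) → Edge (suc k)
    rimEdge i = (rim (inject₁ i) , rim (fsuc i))

  rimNeighbours-inject₁ : ∀ (i : Fin (suc m)) → filter (rimAdj? k (inject₁ i)) (allFin k) ≡ [ fsuc i ]
  rimNeighbours-inject₁ i = filter-tabulate-single (rimAdj? k (inject₁ i)) (λ b → b) (fsuc i)
    (inj₁ (cong suc (sym (Fin.toℕ-inject₁ i))))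
    λ { b b≢ (inj₁ eq)       → b≢ (Fin.toℕ-injective (trans eq (cong suc (Fin.toℕ-inject₁ i))))
      ; b b≢ (inj₂ (eq , _)) → ℕ.<⇒≢ (Fin.toℕ<n i) (ℕ.suc-injective (trans (cong suc (sym (Fin.toℕ-inject₁ i))) eq)) }

  rimNeighbours-last : filter (rimAdj? k (fromℕ (suc m))) (allFin k) ≡ [ fzero ]
  rimNeighbours-last = filter-tabulate-single (rimAdj? k (fromℕ (suc m))) (λ b → b) fzero
    (inj₂ (cong suc (Fin.toℕ-fromℕ (suc m)) , refl))
    λ { b b≢ (inj₁ eq)       → ℕ.<⇒≢ (Fin.toℕ<n b) (trans eq (cong suc (Fin.toℕ-fromℕ (suc m))))
      ; b b≢ (inj₂ (_ , eq)) → b≢ (Fin.toℕ-injective eq) }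

  rimEdges-cycle :
    concatMap (λ a → map (λ b → (rim a , rim b)) (filter (rimAdj? k a) (allFin k))) (allFin k)
    ≡ tabulate rimEdge ++ [ (rim (fromℕ (suc m)) , rim fzero) ]
  rimEdges-cycle = begin
    concatMap g (allFin k)
      ≡⟨ cong (concatMap g) (tabulate-∷ʳ (λ b → b)) ⟩
    concatMap g (tabulate inject₁ ∷ʳ fromℕ (suc m))
      ≡⟨ List.concatMap-++ g (tabulate inject₁) _ ⟩
    concatMap g (tabulate inject₁) ++ concatMap g [ fromℕ (suc m) ]
      ≡⟨ cong₂ _++_ (concatMap-tabulate-single g inject₁ _ λ i → cong (map _) (rimNeighbours-inject₁ i))
                    (cong (λ bs → map (λ b → (rim (fromℕ (suc m)) , rim b)) bs ++ []) rimNeighbours-last) ⟩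
    tabulate rimEdge ++ [ (rim (fromℕ (suc m)) , rim fzero) ]
      ∎
    where
    open ≡-Reasoning
    g = λ a → map (λ b → (rim a , rim b)) (filter (rimAdj? k a) (allFin k))

  ¬onPath-spoke : ∀ (j : Fin k) → ¬ OnPath k (rim j , hub)
  ¬onPath-spoke j (inj₁ (inj₁ (_ , ())))
  ¬onPath-spoke j (inj₁ (inj₂ (_ , eq))) = ℕ.1+n≢n (trans (sym (Fin.toℕ-fromℕ k)) eq)
  ¬onPath-spoke j (inj₂ (inj₁ (_ , ())))
  ¬onPath-spoke j (inj₂ (inj₂ (_ , ())))

  ¬onPath-inner : ∀ (i : Fin m) → ¬ OnPath k (rim (fsuc (inject₁ i)) , rim (fsuc (fsuc i)))
  ¬onPath-inner i (inj₁ (inj₁ (_ , ())))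
  ¬onPath-inner i (inj₁ (inj₂ (() , _)))
  ¬onPath-inner i (inj₂ (inj₁ (() , _)))
  ¬onPath-inner i (inj₂ (inj₂ (_ , ())))

  onPath-last : OnPath k (rim (fromℕ (suc m)) , rim fzero)
  onPath-last = inj₁ (inj₁ (trans (Fin.toℕ-inject₁ (fromℕ (suc m))) (Fin.toℕ-fromℕ (suc m)) , refl))

  filter-rimEdges :
    filter notOnPath (tabulate rimEdge ++ [ (rim (fromℕ (suc m)) , rim fzero) ])
    ≡ pathEdges (rim (fsuc fzero)) (tabulate (rim ∘ fsuc ∘ fsuc))
  filter-rimEdges = begin
    filter notOnPath (tabulate rimEdge ++ [ (rim (fromℕ (suc m)) , rim fzero) ])
      ≡⟨ List.filter-++ notOnPath (tabulate rimEdge) _ ⟩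
    filter notOnPath (tabulate rimEdge) ++ filter notOnPath [ (rim (fromℕ (suc m)) , rim fzero) ]
      ≡⟨ cong₂ _++_ (trans (List.filter-reject notOnPath (λ ¬on → ¬on (inj₂ (inj₁ (refl , refl)))))
                           (List.filter-all notOnPath (All.tabulate⁺ ¬onPath-inner)))
                    (List.filter-reject notOnPath (λ ¬on → ¬on onPath-last)) ⟩
    tabulate (rimEdge ∘ fsuc) ++ []
      ≡⟨ List.++-identityʳ _ ⟩
    tabulate (rimEdge ∘ fsuc)
      ≡⟨ sym (pathEdges-tabulate (rim ∘ fsuc)) ⟩
    pathEdges (rim (fsuc fzero)) (tabulate (rim ∘ fsuc ∘ fsuc))
      ∎
    where open ≡-Reasoning

  wheelMinusPath-spokes-path :
    wheelMinusPath k ≡ spokes hub (tabulate rim) ++ pathEdges (rim (fsuc fzero)) (tabulate (rim ∘ fsuc ∘ fsuc))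
  wheelMinusPath-spokes-path = begin
    wheelMinusPath k
      ≡⟨ List.filter-++ notOnPath (map (λ j → (rim j , hub)) (allFin k)) _ ⟩
    filter notOnPath (map (λ j → (rim j , hub)) (allFin k)) ++ filter notOnPath rimEdges
      ≡⟨ cong₂ _++_ (trans (cong (filter notOnPath) spokes-tabulate)
                           (List.filter-all notOnPath (All.map⁺ (All.tabulate⁺ ¬onPath-spoke))))
                    (trans (cong (filter notOnPath) rimEdges-cycle) filter-rimEdges) ⟩
    spokes hub (tabulate rim) ++ pathEdges (rim (fsuc fzero)) (tabulate (rim ∘ fsuc ∘ fsuc))
      ∎
    where
    open ≡-Reasoning
    rimEdges = concatMap (λ a → map (λ b → (rim a , rim b)) (filter (rimAdj? k a) (allFin k))) (allFin k)
    spokes-tabulate : map (λ j → (rim j , hub)) (allFin k) ≡ spokes hub (tabulate rim)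
    spokes-tabulate = trans (List.map-tabulate (λ j → j) (λ j → (rim j , hub)))
                            (sym (List.map-tabulate rim (λ x → (x , hub))))

BoundedNonVanishing : (k : ℕ) → Monomial (suc k) → Set
BoundedNonVanishing k m =
    ((j : Fin k) → (toℕ j ≡ 0 ⊎ toℕ j ≡ 1 ⊎ suc (toℕ j) ≡ k) → lookup m (rim j) ≡ 0)
  × ((j : Fin k) → 2 ≤ toℕ j → suc (toℕ j) < k → lookup m (rim j) ≤ 2)
  × lookup m hub ≤ 4
  × coeff m (graphPoly (wheelMinusPath k)) ≢ + 0

rimPosition : ∀ {k} (j : Fin k) → (toℕ j ≡ 0 ⊎ toℕ j ≡ 1 ⊎ suc (toℕ j) ≡ k) ⊎ (2 ≤ toℕ j × suc (toℕ j) < k)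
rimPosition {k} j with toℕ j | Fin.toℕ<n j
... | zero        | _ = inj₁ (inj₁ refl)
... | suc zero    | _ = inj₁ (inj₂ (inj₁ refl))
... | suc (suc t) | t<k with suc (suc (suc t)) ℕ.≟ k
...   | yes eq = inj₁ (inj₂ (inj₂ eq))
...   | no  ne = inj₂ (s≤s (s≤s z≤n) , ℕ.≤∧≢⇒< t<k ne)

module _ {m : ℕ} where

  private
    k : ℕ
    k = suc (suc (suc (suc m)))

  interior : List (Fin (suc k))
  interior = tabulate (λ (i : Fin (suc m)) → rim (fsuc (fsuc (inject₁ i))))

  private
    interiorTail : List (Fin (suc k))
    interiorTail = tabulate (λ (i : Fin m) → rim (fsuc (fsuc (fsuc (inject₁ i)))))

  lastRim : Fin (suc k)
  lastRim = rim (fromℕ (suc (suc (suc m))))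

  rims : tabulate (rim {k}) ≡ rim fzero ∷ rim (fsuc fzero) ∷ interior ∷ʳ lastRim
  rims = cong (λ ws → rim fzero ∷ rim (fsuc fzero) ∷ ws) (tabulate-∷ʳ (rim ∘ fsuc ∘ fsuc))

  rims-unique : Unique (rim fzero ∷ rim (fsuc fzero) ∷ interior ∷ʳ lastRim)
  rims-unique = subst Unique rims (Unique.tabulate⁺ Fin.inject₁-injective)

  hub∉rims : All (hub ≢_) (rim fzero ∷ rim (fsuc fzero) ∷ interior ∷ʳ lastRim)
  hub∉rims = subst (All (hub ≢_)) rims (All.tabulate⁺ λ j → Fin.fromℕ≢inject₁ {i = j})

  wheelMinusPath-≡ : wheelMinusPath k ≡ wheelMinusPathOn hub (rim fzero) (rim (fsuc fzero)) interior lastRim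
  wheelMinusPath-≡ = trans wheelMinusPath-spokes-path
    (cong (λ ws → spokes hub (rim fzero ∷ rim (fsuc fzero) ∷ ws) ++ pathEdges (rim (fsuc fzero)) ws)
          (tabulate-∷ʳ (rim ∘ fsuc ∘ fsuc)))

  extremal : List (Fin (suc k))
  extremal = extremalMonomial hub interior

  coeff-extremal : coeff (monomial extremal) (graphPoly (wheelMinusPath k)) ≡ alternating m
  coeff-extremal = begin
    coeff (monomial extremal) (graphPoly (wheelMinusPath k))
      ≡⟨ coeff-monomial-graphPoly extremal (wheelMinusPath k) ⟩
    coeffOf extremal (wheelMinusPath k)
      ≡⟨ cong (coeffOf extremal) wheelMinusPath-≡ ⟩
    coeffOf extremal (wheelMinusPathOn hub (rim fzero) (rim (fsuc fzero)) interior lastRim)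
      ≡⟨ coeffOf-wheelMinusPathOn hub _ _ _ _ _ rims-unique hub∉rims ⟩
    alternating (length interiorTail)
      ≡⟨ cong alternating (List.length-tabulate (λ (i : Fin m) → rim (fsuc (fsuc (fsuc (inject₁ i)))))) ⟩
    alternating m
      ∎
    where open ≡-Reasoning

  private
    interior-unique : Unique interior
    interior-unique = Unique.tabulate⁺
      (Fin.inject₁-injective ∘ Fin.suc-injective ∘ Fin.suc-injective ∘ Fin.inject₁-injective)

    hub∉interior : All (hub ≢_) interior
    hub∉interior = All.++⁻ˡ interior (All.tail (All.tail hub∉rims))

    rim≢hub : ∀ (j : Fin k) → rim j ≢ hub
    rim≢hub j = Fin.fromℕ≢inject₁ ∘ sym

    rim-end∉interior : ∀ (j : Fin k) → toℕ j ≡ 0 ⊎ toℕ j ≡ 1 ⊎ suc (toℕ j) ≡ k → All (rim j ≢_) interior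
    rim-end∉interior j end with rims-unique
    ... | w₀∉ ∷ w₁∉ ∷ uniq with end
    ...   | inj₁ j≡0        rewrite Fin.toℕ-injective {j = fzero} j≡0 = All.++⁻ˡ interior (All.tail w₀∉)
    ...   | inj₂ (inj₁ j≡1) rewrite Fin.toℕ-injective {j = fsuc fzero} j≡1 = All.++⁻ˡ interior w₁∉
    ...   | inj₂ (inj₂ j≡k-1)
      rewrite Fin.toℕ-injective {j = fromℕ (suc (suc (suc m)))}
                (trans (ℕ.suc-injective j≡k-1) (sym (Fin.toℕ-fromℕ _))) =
      Unique-∷ʳ⁻ uniq

    toℕ-rim : ∀ {i j : Fin k} → rim i ≡ rim j → toℕ i ≡ toℕ j
    toℕ-rim = cong toℕ ∘ Fin.inject₁-injective

    rim-inner∈interior : ∀ (j : Fin k) → 2 ≤ toℕ j → suc (toℕ j) < k → rim j ∈ interior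
    rim-inner∈interior j 2≤j j<k-1 with subst (rim j ∈_) rims (∈.∈-tabulate⁺ {f = rim} j)
    ... | here eq          = contradiction (subst (2 ≤_) (toℕ-rim eq) 2≤j) λ ()
    ... | there (here eq)  = contradiction (subst (2 ≤_) (toℕ-rim eq) 2≤j) λ { (s≤s ()) }
    ... | there (there j∈) with ∈.∈-++⁻ interior j∈
    ...   | inj₁ j∈interior = j∈interior
    ...   | inj₂ (here eq)  =
      ⊥-elim (ℕ.<-irrefl refl (subst (λ t → suc t < k) (trans (toℕ-rim eq) (Fin.toℕ-fromℕ _)) j<k-1))

  lookup-extremal-hub : lookup (monomial extremal) hub ≡ 4
  lookup-extremal-hub = lookup-extremalMonomial-hub hub∉interior

  lookup-extremal-end : ∀ (j : Fin k) → toℕ j ≡ 0 ⊎ toℕ j ≡ 1 ⊎ suc (toℕ j) ≡ k →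
                      lookup (monomial extremal) (rim j) ≡ 0
  lookup-extremal-end j end =
    trans (lookup-extremalMonomial-≢ interior (rim≢hub j)) (lookup-monomial-∉ (All-doubled (rim-end∉interior j end)))

  lookup-extremal-inner : ∀ (j : Fin k) → 2 ≤ toℕ j → suc (toℕ j) < k → lookup (monomial extremal) (rim j) ≡ 2
  lookup-extremal-inner j 2≤j j<k-1 =
    trans (lookup-extremalMonomial-≢ interior (rim≢hub j))
          (lookup-monomial-doubled interior-unique (rim-inner∈interior j 2≤j j<k-1))

  -- Degree 2k − 2 leaves no room below the exponent bounds: the monomial is forced.
  boundedNonVanishing⇒extremal : ∀ m' → BoundedNonVanishing k m' → m' ≡ monomial extremal
  boundedNonVanishing⇒extremal m' (end≡0 , inner≤2 , hub≤4 , c≢0) =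
    ≤-pointwise-sum-≡ m' (monomial extremal) below (ℕ.≤-reflexive sums)
    where
    below : ∀ x → lookup m' x ≤ lookup (monomial extremal) x
    below x with view x
    ... | ‵fromℕ     = subst (lookup m' hub ≤_) (sym lookup-extremal-hub) hub≤4
    ... | ‵inject₁ j with rimPosition j
    ...   | inj₁ end            = subst (_≤ _) (sym (end≡0 j end)) z≤n
    ...   | inj₂ (2≤j , j<k-1) = subst (lookup m' (rim j) ≤_) (sym (lookup-extremal-inner j 2≤j j<k-1))
                                       (inner≤2 j 2≤j j<k-1)
    sums : sum (monomial extremal) ≡ sum m'
    sums = begin
      sum (monomial extremal)          ≡⟨ sum-monomial extremal ⟩
      length extremal                  ≡⟨ sym (length-wheelMinusPathOn hub (rim fzero) (rim (fsuc fzero)) _ interiorTail lastRim) ⟩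
      length (wheelMinusPathOn hub (rim fzero) (rim (fsuc fzero)) interior lastRim)
                                     ≡⟨ cong length (sym wheelMinusPath-≡) ⟩
      length (wheelMinusPath k)      ≡⟨ sym (sum-graphCoeff m' E (c≢0 ∘ trans (coeff-graphPoly m' E))) ⟩
      sum m'                         ∎
      where
      open ≡-Reasoning
      E = wheelMinusPath k

  extremal-boundedNonVanishing : 2 ∣ m → BoundedNonVanishing k (monomial extremal)
  extremal-boundedNonVanishing 2∣m =
      (λ j end → lookup-extremal-end j end)
    , (λ j 2≤j j<k-1 → ℕ.≤-reflexive (lookup-extremal-inner j 2≤j j<k-1))
    , ℕ.≤-reflexive lookup-extremal-hub
    , subst (_≢ + 0) (sym coeff-extremal) (Equivalence.from (alternating≢0⇔2∣ m) 2∣m)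

  boundedNonVanishing⇔2∣ : Σ (Monomial (suc k)) (BoundedNonVanishing k) ⇔ 2 ∣ m
  boundedNonVanishing⇔2∣ = mk⇔
    (λ (m' , w@(_ , _ , _ , c≢0)) → Equivalence.to (alternating≢0⇔2∣ m) λ alt≡0 →
       c≢0 (trans (cong (λ v → coeff v (graphPoly (wheelMinusPath k))) (boundedNonVanishing⇒extremal m' w))
                  (trans coeff-extremal alt≡0)))
    (λ 2∣m → monomial extremal , extremal-boundedNonVanishing 2∣m)

-- For k = 3 all rim exponents vanish, yet the remaining rim edge v₂v₃ needs one of them.
triangle : ¬ Σ (Monomial 4) (BoundedNonVanishing 3)
triangle (a ∷ b ∷ c ∷ t ∷ [] , end≡0 , _ , _ , c≢0)
  with end≡0 fzero (inj₁ refl) | end≡0 (fsuc fzero) (inj₂ (inj₁ refl)) | end≡0 (fsuc (fsuc fzero)) (inj₂ (inj₂ refl))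
... | refl | refl | refl = c≢0 refl

theorem5p2 : (k : ℕ) → 3 ≤ k →
    (Σ (Monomial (suc k)) (λ m →
        ((j : Fin k) → (toℕ j ≡ 0 ⊎ toℕ j ≡ 1 ⊎ suc (toℕ j) ≡ k) → lookup m (rim j) ≡ 0)
      × ((j : Fin k) → 2 ≤ toℕ j → suc (toℕ j) < k → lookup m (rim j) ≤ 2)
      × lookup m hub ≤ 4
      × coeff m (graphPoly (wheelMinusPath k)) ≢ + 0))
    ⇔ (2 ∣ k)
theorem5p2 (suc zero)                 (s≤s ())
theorem5p2 (suc (suc zero))           (s≤s (s≤s ()))
theorem5p2 (suc (suc (suc zero)))     _ = mk⇔ (⊥-elim ∘ triangle) (⊥-elim ∘ 2∤1 ∘ Equivalence.to (2∣2+⇔2∣ 1))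
theorem5p2 (suc (suc (suc (suc r)))) _ = ⇔-sym (2∣4+⇔2∣ r) ⇔-∘ boundedNonVanishing⇔2∣
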